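{- Fix an integer $k\ge 3$. As $n\to\infty$, $$\left(\frac{1}{8}+o(1)\right)2^{kn}\le P(n,k)\le\left(\left(\frac{k-1}{k}\right)^k+o(1)\right)2^{kn}.$$
   Context: Write $[n]=\{1,\ldots,n\}$ and $2^{[n]}$ for the family of all subsets of $[n]$. Given families ${\cal A}_1,\ldots,{\cal A}_k\subset 2^{[n]}$, a multicolor sunflower with $k$ petals is a choice of sets $A_i\in{\cal A}_i$, $i=1,\ldots,k$, together with a set $C$ such that $A_i\cap A_j=C$ for all $i\neq j$ and $A_i\setminus C\neq\emptyset$ for all $i\in[k]$. The tuple ${\cal A}_1,\ldots,{\cal A}_k$ is called sunflower-free if it contains no multicolor sunflower with $k$ petals. Let ${\cal F}(n,k)$ be the set of all $k$-tuples $({\cal A}_1,\ldots,{\cal A}_k)$ of families ${\cal A}_i\subset 2^{[n]}$ that are sunflower-free, and define $P(n,k)=\max_{({\cal A}_i)\in{\cal F}(n,k)}\prod_{i=1}^k|{\cal A}_i|$. -}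

module Defs where

open import Data.Nat as ℕ using (ℕ; zero; suc)
open import Data.Integer using (+_)
open import Data.Rational as ℚ using (ℚ; 0ℚ; 1ℚ)
open import Data.Fin using (Fin)
open import Data.Fin.Subset using (Subset; _∩_; _─_; Nonempty)
open import Data.List using (List; length)
open import Data.List.Membership.Propositional using () renaming (_∈_ to _∈ₗ_)
open import Data.List.Relation.Unary.Unique.Propositional using (Unique)
open import Data.Product using (Σ; _×_)
open import Relation.Binary.PropositionalEquality using (_≡_; _≢_)
open import Relation.Nullary using (¬_)

record Family (n : ℕ) : Set where
  constructor family
  field
    members : List (Subset n)
    distinct : Unique members

open Family public

card : ∀ {n} → Family n → ℕ
card 𝒜 = length (members 𝒜)

prodFin : ∀ k → (Fin k → ℕ) → ℕ
prodFin zero f = 1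
prodFin (suc k) f = f Fin.zero ℕ.* prodFin k (λ i → f (Fin.suc i))
  where import Data.Fin as Fin

MulticolorSunflower : ∀ {n k} → (Fin k → Family n) → Set
MulticolorSunflower {n} {k} 𝒜 =
  Σ (Fin k → Subset n) λ A →
  Σ (Subset n) λ C →
    (∀ i → A i ∈ₗ members (𝒜 i)) ×
    (∀ i j → i ≢ j → A i ∩ A j ≡ C) ×
    (∀ i → Nonempty (A i ─ C))

SunflowerFree : ∀ {n k} → (Fin k → Family n) → Set
SunflowerFree 𝒜 = ¬ MulticolorSunflower 𝒜

prodCard : ∀ {n k} → (Fin k → Family n) → ℕ
prodCard {k = k} 𝒜 = prodFin k (λ i → card (𝒜 i))

toℚ : ℕ → ℚ
toℚ m = (+ m) ℚ./ 1

-- m / d as a rational (d > 0 in all uses; d = 0 gives 0 by convention)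
_/ℕ_ : ℕ → ℕ → ℚ
m /ℕ zero = 0ℚ
m /ℕ suc d = (+ m) ℚ./ suc d

_^ℚ_ : ℚ → ℕ → ℚ
q ^ℚ zero = 1ℚ
q ^ℚ suc e = q ℚ.* (q ^ℚ e)

-- Upper bound: label every coordinate independently as core (weight k − 1), absent, or
-- petal j (weight 1 each), and let Sᵢ be the coordinates labelled core or petal i. Each Sᵢ
-- is uniform, and Sᵢ ∩ Sⱼ is the core for i ≠ j, so when every petal label occurs the Sᵢ
-- form a sunflower and at most k − 1 of them lie in their families. A petal label is missing
-- with probability at most k ((2k − 1)/2k)ⁿ, hence Σᵢ |𝒜ᵢ| ≤ (k − 1 + o(1)) 2ⁿ, and AM–GM
-- gives ∏ᵢ |𝒜ᵢ| ≤ (((k − 1)/k)ᵏ + o(1)) 2ᵏⁿ.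
-- Lower bound: take the sets containing the first element twice, the sets avoiding it once,
-- and all sets for the remaining k − 3 families.

module Submission where

open import Defs
open import Data.Nat using (ℕ; _≤_; _*_; _^_; _∸_)
open import Data.Rational using (ℚ; Positive; 1ℚ) renaming (_≤_ to _≤ℚ_; _+_ to _+ℚ_; _-_ to _-ℚ_; _*_ to _*ℚ_)
open import Data.Fin using (Fin)
open import Data.Product using (Σ; _×_)

open import Data.Nat using (zero; suc; _+_; z≤n; s≤s; NonZero)
import Data.Nat as ℕ
open import Data.Nat.Properties hiding (_≟_)
open import Data.Nat.Tactic.RingSolver using (solve-∀)
open import Data.Nat.Coprimality using (Coprime)
import Data.Integer as ℤ
import Data.Integer.Properties as ℤ
import Data.Rational as ℚ
open import Data.Rational using (0ℚ; toℚᵘ)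
import Data.Rational.Properties as ℚ
open import Data.Rational.Unnormalised as ℚᵘ using (mkℚᵘ; *≤*)
import Data.Rational.Unnormalised.Properties as ℚᵘ
open import Data.Bool using (Bool; true; false; if_then_else_; _∧_)
import Data.Bool.Properties as Bool
open import Data.Fin using (zero; suc; punchIn)
open import Data.Fin.Properties using (_≟_; all?; ¬∀⟶∃¬)
open import Data.Fin.Subset using (Subset; _∩_; _─_; Nonempty)
open import Data.Vec as Vec using (Vec; []; _∷_; here; there; head)
open import Data.Vec.Properties using (≡-dec; ∷-injectiveʳ)
open import Data.Vec.Functional using (removeAt)
open import Data.List as List using (List; []; _∷_; _++_; length)
open import Data.List.Properties using (length-++; length-map)
open import Data.List.Relation.Unary.All using (All; []; _∷_)
open import Data.List.Relation.Unary.Any using (here; there)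
open import Data.List.Relation.Unary.AllPairs using ([]; _∷_)
open import Data.List.Relation.Unary.Unique.Propositional using (Unique)
open import Data.List.Relation.Unary.Unique.Propositional.Properties using (map⁺; ++⁺)
open import Data.List.Membership.Propositional using (_∈_)
open import Data.List.Membership.Propositional.Properties using (∈-map⁻)
open import Data.Product using (_,_)
import Data.Product
open import Data.Sum using (inj₁; inj₂)
open import Data.Empty using (⊥; ⊥-elim)
open import Function using (_∘_)
open import Relation.Nullary using (does; yes; no; contradiction)
open import Relation.Binary.Definitions using (DecidableEquality)
open import Relation.Binary.PropositionalEquality
open import Algebra.Properties.Semiring.Sum +-*-semiring using (sum; sum-remove; sum-cong-≗; *-distribˡ-sum; ∑-distrib-+)
open import Algebra.Properties.CommutativeSemigroup +-commutativeSemigroup using (x∙yz≈y∙xz; interchange)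
import Algebra.Properties.CommutativeSemigroup *-commutativeSemigroup as *-Comm

sum-mono-≤ : ∀ {k} {f g : Fin k → ℕ} → (∀ i → f i ≤ g i) → sum f ≤ sum g
sum-mono-≤ {zero} f≤g = z≤n
sum-mono-≤ {suc k} f≤g = +-mono-≤ (f≤g zero) (sum-mono-≤ (f≤g ∘ suc))

sum-const : ∀ k c → sum {k} (λ _ → c) ≡ k * c
sum-const zero c = refl
sum-const (suc k) c = cong (c +_) (sum-const k c)

sum-indicator : ∀ a (i : Fin (suc a)) (F : Bool → ℕ) →
  sum (λ j → F (does (j ≟ i))) ≡ F true + a * F false
sum-indicator a zero F = cong (F true +_) (sum-const a (F false))
sum-indicator (suc a) (suc i) F = begin
  F false + sum (λ j → F (does (j ≟ i))) ≡⟨ cong (F false +_) (sum-indicator a i F) ⟩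
  F false + (F true + a * F false)        ≡⟨ x∙yz≈y∙xz (F false) (F true) (a * F false) ⟩
  F true + (F false + a * F false)        ∎
  where open ≡-Reasoning

≤-sum : ∀ {k} (f : Fin k → ℕ) i → f i ≤ sum f
≤-sum {suc k} f i = ≤-trans (m≤m+n (f i) _) (≤-reflexive (sym (sum-remove {i = i} f)))

sum-≤-pred : ∀ {a} (f : Fin (suc a) → ℕ) i → f i ≡ 0 → (∀ j → f j ≤ 1) → sum f ≤ a
sum-≤-pred {a} f i fi≡0 f≤1 = begin
  sum f                     ≡⟨ sum-remove {i = i} f ⟩
  f i + sum (removeAt f i)  ≡⟨ cong (_+ sum (removeAt f i)) fi≡0 ⟩
  sum (removeAt f i)        ≤⟨ sum-mono-≤ (f≤1 ∘ punchIn i) ⟩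
  sum {a} (λ _ → 1)         ≡⟨ sum-const a 1 ⟩
  a * 1                     ≡⟨ *-identityʳ a ⟩
  a                         ∎
  where open ≤-Reasoning

-- The AM–GM inequality

^-distribʳ-* : ∀ x y m → (x * y) ^ m ≡ x ^ m * y ^ m
^-distribʳ-* x y zero = refl
^-distribʳ-* x y (suc m) = trans (cong (x * y *_) (^-distribʳ-* x y m)) (lemma x y (x ^ m) (y ^ m))
  where
  lemma : ∀ x y u v → x * y * (u * v) ≡ x * u * (y * v)
  lemma = solve-∀

tangent-≤-^ : ∀ m A d → A ^ suc m + suc m * (A ^ m * d) ≤ (A + d) ^ suc m
tangent-≤-^ zero A d = ≤-reflexive (lemma A d)
  where
  lemma : ∀ A d → A * 1 + (1 * d + 0) ≡ (A + d) * 1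
  lemma = solve-∀
tangent-≤-^ (suc m) A d = begin
  A * (A * X) + suc (suc m) * (A * X * d)                     ≤⟨ m≤m+n _ _ ⟩
  A * (A * X) + suc (suc m) * (A * X * d) + suc m * X * d * d ≡⟨ lemma m A d X ⟩
  (A + d) * (A * X + suc m * (X * d))                         ≤⟨ *-monoʳ-≤ (A + d) (tangent-≤-^ m A d) ⟩
  (A + d) * (A + d) ^ suc m                                   ∎
  where
  open ≤-Reasoning
  X = A ^ m
  lemma : ∀ m A d X → A * (A * X) + suc (suc m) * (A * X * d) + suc m * X * d * d
                    ≡ (A + d) * (A * X + suc m * (X * d))
  lemma = solve-∀

^-≤-mean-value : ∀ m B e → (B + e) ^ suc m ≤ B ^ suc m + suc m * (e * (B + e) ^ m)
^-≤-mean-value zero B e = ≤-reflexive (lemma B e)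
  where
  lemma : ∀ B e → (B + e) * 1 ≡ B * 1 + (e * 1 + 0)
  lemma = solve-∀
^-≤-mean-value (suc m) B e = begin
  (B + e) * (B + e) ^ suc m                         ≤⟨ *-monoʳ-≤ (B + e) (^-≤-mean-value m B e) ⟩
  (B + e) * (Z + suc m * (e * Y))                   ≡⟨ lemma₁ m B e Z Y ⟩
  B * Z + e * Z + suc m * (e * ((B + e) * Y))       ≤⟨ +-monoˡ-≤ _ (+-monoʳ-≤ (B * Z) (*-monoʳ-≤ e Z≤[B+e]Y)) ⟩
  B * Z + e * W + suc m * (e * W)                   ≡⟨ lemma₂ m B e Z W ⟩
  B * Z + suc (suc m) * (e * W)                     ∎
  where
  open ≤-Reasoning
  Z = B ^ suc m
  Y = (B + e) ^ m
  W = (B + e) * Y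
  Z≤[B+e]Y : Z ≤ W
  Z≤[B+e]Y = ^-monoˡ-≤ (suc m) (m≤m+n B e)
  lemma₁ : ∀ m B e Z Y → (B + e) * (Z + suc m * (e * Y)) ≡ B * Z + e * Z + suc m * (e * ((B + e) * Y))
  lemma₁ = solve-∀
  lemma₂ : ∀ m B e Z W → B * Z + e * W + suc m * (e * W) ≡ B * Z + suc (suc m) * (e * W)
  lemma₂ = solve-∀

-- Compare u and v: if u = v + d use the tangent bound at (m+1)v, if v = u + e the
-- mean-value bound at u + m v.
am-gm₂ : ∀ m u v → suc m ^ suc m * (u * v ^ m) ≤ (u + m * v) ^ suc m
am-gm₂ m u v with ≤-total v u
... | inj₁ v≤u with m≤n⇒∃[o]m+o≡n v≤u
...   | d , refl = begin
  suc m ^ suc m * ((v + d) * v ^ m)                         ≡⟨ lemma₁ m v d (suc m ^ m) (v ^ m) ⟩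
  M * (suc m ^ m * v ^ m) + suc m * (suc m ^ m * v ^ m * d) ≡⟨ cong (λ X → M * X + suc m * (X * d)) (sym (^-distribʳ-* (suc m) v m)) ⟩
  M ^ suc m + suc m * (M ^ m * d)                           ≤⟨ tangent-≤-^ m M d ⟩
  (M + d) ^ suc m                                           ≡⟨ cong (_^ suc m) (lemma₂ m v d) ⟩
  (v + d + m * v) ^ suc m                                   ∎
  where
  open ≤-Reasoning
  M = suc m * v
  lemma₁ : ∀ m v d P V → suc m * P * ((v + d) * V) ≡ suc m * v * (P * V) + suc m * (P * V * d)
  lemma₁ = solve-∀
  lemma₂ : ∀ m v d → suc m * v + d ≡ v + d + m * v
  lemma₂ = solve-∀
am-gm₂ m u v | inj₂ u≤v with m≤n⇒∃[o]m+o≡n u≤v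
...   | e , refl = +-cancelʳ-≤ X _ _ (begin
  suc m ^ suc m * (u * (u + e) ^ m) + X     ≡⟨ lemma₁ m u e (suc m ^ m) ((u + e) ^ m) ⟩
  M * (suc m ^ m * (u + e) ^ m)             ≡⟨ cong (M *_) (sym (^-distribʳ-* (suc m) (u + e) m)) ⟩
  M ^ suc m                                 ≡⟨ cong (_^ suc m) M≡B+e ⟩
  (B + e) ^ suc m                           ≤⟨ ^-≤-mean-value m B e ⟩
  B ^ suc m + suc m * (e * (B + e) ^ m)     ≡⟨ cong (λ Q → B ^ suc m + suc m * (e * Q ^ m)) (sym M≡B+e) ⟩
  B ^ suc m + suc m * (e * M ^ m)           ≡⟨ cong (λ Q → B ^ suc m + suc m * (e * Q)) (^-distribʳ-* (suc m) (u + e) m) ⟩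
  B ^ suc m + X                             ∎)
  where
  open ≤-Reasoning
  M = suc m * (u + e)
  B = u + m * (u + e)
  X = suc m * (e * (suc m ^ m * (u + e) ^ m))
  M≡B+e : M ≡ B + e
  M≡B+e = lemma₂ m u e
    where
    lemma₂ : ∀ m u e → suc m * (u + e) ≡ u + m * (u + e) + e
    lemma₂ = solve-∀
  lemma₁ : ∀ m u e P V → suc m * P * (u * V) + suc m * (e * (P * V)) ≡ suc m * (u + e) * (P * V)
  lemma₁ = solve-∀

am-gm : ∀ k (f : Fin k → ℕ) → k ^ k * prodFin k f ≤ sum f ^ k
am-gm zero f = ≤-refl
am-gm (suc zero) f = ≤-reflexive (lemma (f zero))
  where
  lemma : ∀ x → 1 * (x * 1) ≡ (x + 0) * 1
  lemma = solve-∀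
am-gm (suc m@(suc _)) f = *-cancelˡ-≤ (m * m ^ m) {{m*n≢0 m (m ^ m) {{_}} {{m^n≢0 m m}}}} (begin
  m * m ^ m * (suc m ^ suc m * (f₀ * P)) ≡⟨ lemma₁ m (m ^ m) (suc m ^ suc m) f₀ P ⟩
  m * (suc m ^ suc m * (f₀ * (m ^ m * P))) ≤⟨ *-monoʳ-≤ m (*-monoʳ-≤ (suc m ^ suc m) (*-monoʳ-≤ f₀ (am-gm m (f ∘ suc)))) ⟩
  m * (suc m ^ suc m * (f₀ * T ^ m))     ≡⟨ lemma₂ m (suc m ^ suc m) f₀ (T ^ m) ⟩
  suc m ^ suc m * (m * f₀ * T ^ m)       ≤⟨ am-gm₂ m (m * f₀) T ⟩
  (m * f₀ + m * T) ^ suc m               ≡⟨ cong (_^ suc m) (sym (*-distribˡ-+ m f₀ T)) ⟩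
  (m * (f₀ + T)) ^ suc m                 ≡⟨ ^-distribʳ-* m (f₀ + T) (suc m) ⟩
  m * m ^ m * (f₀ + T) ^ suc m           ∎)
  where
  open ≤-Reasoning
  f₀ = f zero
  P = prodFin m (f ∘ suc)
  T = sum (f ∘ suc)
  lemma₁ : ∀ m M S f P → m * M * (S * (f * P)) ≡ m * (S * (f * (M * P)))
  lemma₁ = solve-∀
  lemma₂ : ∀ m S f Q → m * (S * (f * Q)) ≡ S * (m * f * Q)
  lemma₂ = solve-∀

_≟ˢ_ : ∀ {n} → DecidableEquality (Subset n)
_≟ˢ_ = ≡-dec Bool._≟_

subsetSum : ∀ n → (Subset n → ℕ) → ℕ
subsetSum zero h = h []
subsetSum (suc n) h = subsetSum n (h ∘ (true ∷_)) + subsetSum n (h ∘ (false ∷_))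

subsetSum-zero : ∀ n → subsetSum n (λ _ → 0) ≡ 0
subsetSum-zero zero = refl
subsetSum-zero (suc n) = cong₂ _+_ (subsetSum-zero n) (subsetSum-zero n)

subsetSum-+ : ∀ n (f g : Subset n → ℕ) → subsetSum n (λ S → f S + g S) ≡ subsetSum n f + subsetSum n g
subsetSum-+ zero f g = refl
subsetSum-+ (suc n) f g =
  trans (cong₂ _+_ (subsetSum-+ n (f ∘ (true ∷_)) (g ∘ (true ∷_))) (subsetSum-+ n (f ∘ (false ∷_)) (g ∘ (false ∷_))))
        (interchange (subsetSum n (f ∘ (true ∷_))) (subsetSum n (g ∘ (true ∷_)))
                     (subsetSum n (f ∘ (false ∷_))) (subsetSum n (g ∘ (false ∷_))))

indicator : Bool → ℕ
indicator b = if b then 1 else 0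

subsetSum-point : ∀ {n} (T : Subset n) → subsetSum n (λ S → indicator (does (S ≟ˢ T))) ≡ 1
subsetSum-point [] = refl
subsetSum-point {suc n} (true ∷ T) = cong₂ _+_ (subsetSum-point T) (subsetSum-zero n)
subsetSum-point {suc n} (false ∷ T) = cong₂ _+_ (subsetSum-zero n) (subsetSum-point T)

multiplicity : ∀ {n} → List (Subset n) → Subset n → ℕ
multiplicity [] S = 0
multiplicity (T ∷ Ts) S = indicator (does (S ≟ˢ T)) + multiplicity Ts S

subsetSum-multiplicity : ∀ n (Ts : List (Subset n)) → subsetSum n (multiplicity Ts) ≡ length Ts
subsetSum-multiplicity n [] = subsetSum-zero n
subsetSum-multiplicity n (T ∷ Ts) =
  trans (subsetSum-+ n _ (multiplicity Ts)) (cong₂ _+_ (subsetSum-point T) (subsetSum-multiplicity n Ts))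

multiplicity-∉ : ∀ {n} (S : Subset n) Ts → All (S ≢_) Ts → multiplicity Ts S ≡ 0
multiplicity-∉ S [] [] = refl
multiplicity-∉ S (T ∷ Ts) (S≢T ∷ S∉Ts) with S ≟ˢ T
... | yes S≡T = contradiction S≡T S≢T
... | no _ = multiplicity-∉ S Ts S∉Ts

multiplicity-≤1 : ∀ {n} (S : Subset n) Ts → Unique Ts → multiplicity Ts S ≤ 1
multiplicity-≤1 S [] [] = z≤n
multiplicity-≤1 S (T ∷ Ts) (T∉Ts ∷ uniq) with S ≟ˢ T
... | yes refl = ≤-reflexive (cong suc (multiplicity-∉ S Ts T∉Ts))
... | no _ = multiplicity-≤1 S Ts uniq

multiplicity⇒∈ : ∀ {n} (S : Subset n) Ts → 1 ≤ multiplicity Ts S → S ∈ Ts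
multiplicity⇒∈ S (T ∷ Ts) 1≤m with S ≟ˢ T
... | yes S≡T = here S≡T
... | no _ = there (multiplicity⇒∈ S Ts 1≤m)

-- Random labellings

data Label (k : ℕ) : Set where
  core absent : Label k
  petal : Fin k → Label k

module LabelledCube (a : ℕ) where

  k : ℕ
  k = suc a

  -- Sum over labellings of [n] with a core label counted k − 1 times: (2k)ⁿ times the
  -- expectation of g for a random labelling.
  cubeSum : ∀ n → (Vec (Label k) n → ℕ) → ℕ
  cubeSum zero g = g []
  cubeSum (suc n) g = a * cubeSum n (g ∘ (core ∷_)) + cubeSum n (g ∘ (absent ∷_))
                      + sum (λ j → cubeSum n (g ∘ (petal j ∷_)))

  cubeSum-mono-≤ : ∀ n {f g : Vec (Label k) n → ℕ} → (∀ L → f L ≤ g L) → cubeSum n f ≤ cubeSum n g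
  cubeSum-mono-≤ zero f≤g = f≤g []
  cubeSum-mono-≤ (suc n) f≤g =
    +-mono-≤ (+-mono-≤ (*-monoʳ-≤ a (cubeSum-mono-≤ n (f≤g ∘ (core ∷_)))) (cubeSum-mono-≤ n (f≤g ∘ (absent ∷_))))
             (sum-mono-≤ (λ j → cubeSum-mono-≤ n (f≤g ∘ (petal j ∷_))))

  cubeSum-+ : ∀ n (f g : Vec (Label k) n → ℕ) → cubeSum n (λ L → f L + g L) ≡ cubeSum n f + cubeSum n g
  cubeSum-+ zero f g = refl
  cubeSum-+ (suc n) f g = begin
    a * cubeSum n (λ L → f (core ∷ L) + g (core ∷ L)) + cubeSum n (λ L → f (absent ∷ L) + g (absent ∷ L))
      + sum (λ j → cubeSum n (λ L → f (petal j ∷ L) + g (petal j ∷ L)))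
      ≡⟨ cong₂ _+_ (cong₂ (λ x y → a * x + y) (cubeSum-+ n (f ∘ (core ∷_)) (g ∘ (core ∷_))) (cubeSum-+ n (f ∘ (absent ∷_)) (g ∘ (absent ∷_))))
               (trans (sum-cong-≗ (λ j → cubeSum-+ n (f ∘ (petal j ∷_)) (g ∘ (petal j ∷_)))) (∑-distrib-+ fP gP)) ⟩
    a * (fc + gc) + (fo + go) + (fp + gp)
      ≡⟨ lemma a fc gc fo go fp gp ⟩
    (a * fc + fo + fp) + (a * gc + go + gp) ∎
    where
    open ≡-Reasoning
    fc = cubeSum n (f ∘ (core ∷_))
    gc = cubeSum n (g ∘ (core ∷_))
    fo = cubeSum n (f ∘ (absent ∷_))
    go = cubeSum n (g ∘ (absent ∷_))
    fP gP : Fin k → ℕ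
    fP j = cubeSum n (f ∘ (petal j ∷_))
    gP j = cubeSum n (g ∘ (petal j ∷_))
    fp = sum fP
    gp = sum gP
    lemma : ∀ a x y z w u v → a * (x + y) + (z + w) + (u + v) ≡ (a * x + z + u) + (a * y + w + v)
    lemma = solve-∀

  cubeSum-const : ∀ n c → cubeSum n (λ _ → c) ≡ c * (2 * k) ^ n
  cubeSum-const zero c = sym (*-identityʳ c)
  cubeSum-const (suc n) c = begin
    a * cubeSum n (λ _ → c) + cubeSum n (λ _ → c) + sum {k} (λ _ → cubeSum n (λ _ → c))
      ≡⟨ cong (λ X → a * X + X + sum {k} (λ _ → X)) (cubeSum-const n c) ⟩
    a * X + X + sum {k} (λ _ → X)  ≡⟨ cong (a * X + X +_) (sum-const k X) ⟩
    a * X + X + k * X              ≡⟨ lemma a c ((2 * k) ^ n) ⟩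
    c * (2 * k) ^ suc n            ∎
    where
    open ≡-Reasoning
    X = c * (2 * k) ^ n
    lemma : ∀ a c x → a * (c * x) + c * x + suc a * (c * x) ≡ c * (2 * suc a * x)
    lemma = solve-∀

  cubeSum-sum : ∀ n {m} (f : Fin m → Vec (Label k) n → ℕ) →
    cubeSum n (λ L → sum (λ i → f i L)) ≡ sum (λ i → cubeSum n (f i))
  cubeSum-sum n {zero} f = cubeSum-const n 0
  cubeSum-sum n {suc m} f =
    trans (cubeSum-+ n (f zero) (λ L → sum (λ i → f (suc i) L))) (cong (cubeSum n (f zero) +_) (cubeSum-sum n (f ∘ suc)))

  inPetal : Fin k → Label k → Bool
  inPetal i core = true
  inPetal i absent = false
  inPetal i (petal j) = does (j ≟ i)

  petalSet : ∀ {n} → Fin k → Vec (Label k) n → Subset n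
  petalSet i = Vec.map (inPetal i)

  isCore : Label k → Bool
  isCore core = true
  isCore absent = false
  isCore (petal _) = false

  coreSet : ∀ {n} → Vec (Label k) n → Subset n
  coreSet = Vec.map isCore

  cubeSum-petalSet : ∀ n (i : Fin k) (h : Subset n → ℕ) → cubeSum n (h ∘ petalSet i) ≡ k ^ n * subsetSum n h
  cubeSum-petalSet zero i h = sym (+-identityʳ (h []))
  cubeSum-petalSet (suc n) i h = begin
    a * F true + F false + sum (λ j → F (does (j ≟ i)))  ≡⟨ cong (a * F true + F false +_) (sum-indicator a i F) ⟩
    a * F true + F false + (F true + a * F false)        ≡⟨ cong₂ (λ x y → a * x + y + (x + a * y)) (cubeSum-petalSet n i _) (cubeSum-petalSet n i _) ⟩
    a * (K * x) + K * y + (K * x + a * (K * y))          ≡⟨ lemma a K x y ⟩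
    k * K * (x + y)                                      ∎
    where
    open ≡-Reasoning
    F : Bool → ℕ
    F b = cubeSum n (λ L → h (b ∷ petalSet i L))
    K = k ^ n
    x = subsetSum n (h ∘ (true ∷_))
    y = subsetSum n (h ∘ (false ∷_))
    lemma : ∀ a K x y → a * (K * x) + K * y + (K * x + a * (K * y)) ≡ suc a * K * (x + y)
    lemma = solve-∀

  noPetal : ∀ {n} → Fin k → Vec (Label k) n → ℕ
  noPetal i [] = 1
  noPetal i (core ∷ L) = noPetal i L
  noPetal i (absent ∷ L) = noPetal i L
  noPetal i (petal j ∷ L) = if does (j ≟ i) then 0 else noPetal i L

  cubeSum-noPetal : ∀ n (i : Fin k) → cubeSum n (noPetal i) ≡ suc (2 * a) ^ n
  cubeSum-noPetal zero i = refl
  cubeSum-noPetal (suc n) i = begin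
    a * X + X + sum (λ j → F (does (j ≟ i)))  ≡⟨ cong (a * X + X +_) (sum-indicator a i F) ⟩
    a * X + X + (F true + a * X)              ≡⟨ cong (λ z → a * X + X + (z + a * X)) (cubeSum-const n 0) ⟩
    a * X + X + a * X                         ≡⟨ cong (λ z → a * z + z + a * z) (cubeSum-noPetal n i) ⟩
    a * E + E + a * E                         ≡⟨ lemma a E ⟩
    suc (2 * a) * E                           ∎
    where
    open ≡-Reasoning
    F : Bool → ℕ
    F b = cubeSum n (λ L → if b then 0 else noPetal i L)
    X = cubeSum n (noPetal i)
    E = suc (2 * a) ^ n
    lemma : ∀ a E → a * E + E + a * E ≡ suc (2 * a) * E
    lemma = solve-∀

  inPetal-∧ : ∀ {i j} → i ≢ j → ∀ l → inPetal i l ∧ inPetal j l ≡ isCore l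
  inPetal-∧ i≢j core = refl
  inPetal-∧ i≢j absent = refl
  inPetal-∧ {i} {j} i≢j (petal m) with m ≟ i | m ≟ j
  ... | yes refl | yes refl = contradiction refl i≢j
  ... | yes _    | no _     = refl
  ... | no _     | _        = refl

  petalSet-∩ : ∀ {n i j} → i ≢ j → (L : Vec (Label k) n) → petalSet i L ∩ petalSet j L ≡ coreSet L
  petalSet-∩ i≢j [] = refl
  petalSet-∩ i≢j (l ∷ L) = cong₂ _∷_ (inPetal-∧ i≢j l) (petalSet-∩ i≢j L)

  noPetal≡0⇒nonempty : ∀ {n} i (L : Vec (Label k) n) → noPetal i L ≡ 0 → Nonempty (petalSet i L ─ coreSet L)
  noPetal≡0⇒nonempty i (core ∷ L) eq = Data.Product.map suc there (noPetal≡0⇒nonempty i L eq)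
  noPetal≡0⇒nonempty i (absent ∷ L) eq = Data.Product.map suc there (noPetal≡0⇒nonempty i L eq)
  noPetal≡0⇒nonempty i (petal j ∷ L) eq with j ≟ i
  ... | yes _ = zero , here
  ... | no _ = Data.Product.map suc there (noPetal≡0⇒nonempty i L eq)

  module _ {n : ℕ} (𝒜 : Fin k → Family n) (𝒜-sunflowerFree : SunflowerFree 𝒜) where

    hits : Fin k → Vec (Label k) n → ℕ
    hits i L = multiplicity (members (𝒜 i)) (petalSet i L)

    hits≤1 : ∀ i L → hits i L ≤ 1
    hits≤1 i L = multiplicity-≤1 (petalSet i L) (members (𝒜 i)) (distinct (𝒜 i))

    -- If every petal is nonempty, the petal sets form a sunflower with core coreSet L,
    -- so they cannot all be members.
    sum-hits-≤ : ∀ L → sum (λ i → hits i L) ≤ a + sum (λ j → noPetal j L)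
    sum-hits-≤ L with all? (λ j → noPetal j L ℕ.≟ 0)
    ... | no ¬allPetals with ¬∀⟶∃¬ k _ (λ j → noPetal j L ℕ.≟ 0) ¬allPetals
    ...   | j , missing = begin
      sum (λ i → hits i L)          ≤⟨ sum-mono-≤ (λ i → hits≤1 i L) ⟩
      sum {k} (λ _ → 1)             ≡⟨ trans (sum-const k 1) (trans (*-identityʳ k) (+-comm 1 a)) ⟩
      a + 1                         ≤⟨ +-monoʳ-≤ a (≤-trans (n≢0⇒n>0 missing) (≤-sum (λ j → noPetal j L) j)) ⟩
      a + sum (λ j → noPetal j L)   ∎
      where open ≤-Reasoning
    sum-hits-≤ L | yes allPetals with all? (λ i → 1 ℕ.≤? hits i L)
    ... | yes allHit = ⊥-elim (𝒜-sunflowerFree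
           ( (λ i → petalSet i L) , coreSet L
           , (λ i → multiplicity⇒∈ (petalSet i L) (members (𝒜 i)) (allHit i))
           , (λ i j i≢j → petalSet-∩ i≢j L)
           , (λ i → noPetal≡0⇒nonempty i L (allPetals i))))
    ... | no ¬allHit with ¬∀⟶∃¬ k _ (λ i → 1 ℕ.≤? hits i L) ¬allHit
    ...   | i , missed = ≤-trans (sum-≤-pred (λ i → hits i L) i (n<1⇒n≡0 (≰⇒> missed)) (λ i → hits≤1 i L)) (m≤m+n a _)

    sum-card-≤ : k ^ n * sum (λ i → card (𝒜 i)) ≤ a * (2 * k) ^ n + k * suc (2 * a) ^ n
    sum-card-≤ = begin
      k ^ n * sum (λ i → card (𝒜 i))                ≡⟨ *-distribˡ-sum (k ^ n) (λ i → card (𝒜 i)) ⟩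
      sum (λ i → k ^ n * card (𝒜 i))                ≡⟨ sum-cong-≗ cubeSum-hits ⟨
      sum (λ i → cubeSum n (hits i))                ≡⟨ cubeSum-sum n hits ⟨
      cubeSum n (λ L → sum (λ i → hits i L))        ≤⟨ cubeSum-mono-≤ n sum-hits-≤ ⟩
      cubeSum n (λ L → a + sum (λ j → noPetal j L)) ≡⟨ cubeSum-+ n (λ _ → a) _ ⟩
      cubeSum n (λ _ → a) + cubeSum n (λ L → sum (λ j → noPetal j L))
        ≡⟨ cong₂ _+_ (cubeSum-const n a) (cubeSum-sum n noPetal) ⟩
      a * (2 * k) ^ n + sum (λ j → cubeSum n (noPetal j))
        ≡⟨ cong (a * (2 * k) ^ n +_) (trans (sum-cong-≗ (cubeSum-noPetal n)) (sum-const k _)) ⟩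
      a * (2 * k) ^ n + k * suc (2 * a) ^ n         ∎
      where
      open ≤-Reasoning
      cubeSum-hits : ∀ i → cubeSum n (hits i) ≡ k ^ n * card (𝒜 i)
      cubeSum-hits i = trans (cubeSum-petalSet n i _) (cong (k ^ n *_) (subsetSum-multiplicity n (members (𝒜 i))))

n*m^n≤m*[m+1]^n : ∀ m n → n * m ^ n ≤ m * (m + 1) ^ n
n*m^n≤m*[m+1]^n m zero = z≤n
n*m^n≤m*[m+1]^n m (suc n) = begin
  suc n * (m * m ^ n)                   ≡⟨ lemma n m (m ^ n) ⟩
  m * (suc n * (m ^ n * 1))             ≤⟨ *-monoʳ-≤ m (m≤n+m _ (m ^ suc n)) ⟩
  m * (m ^ suc n + suc n * (m ^ n * 1)) ≤⟨ *-monoʳ-≤ m (tangent-≤-^ n m 1) ⟩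
  m * (m + 1) ^ suc n                   ∎
  where
  open ≤-Reasoning
  lemma : ∀ n m X → suc n * (m * X) ≡ m * (suc n * (X * 1))
  lemma = solve-∀

c*m^n≤[m+1]^n : ∀ c m n .{{_ : NonZero m}} → c * m ≤ n → c * m ^ n ≤ (m + 1) ^ n
c*m^n≤[m+1]^n c m n cm≤n = *-cancelˡ-≤ m (begin
  m * (c * m ^ n)   ≡⟨ lemma c m (m ^ n) ⟩
  c * m * m ^ n     ≤⟨ *-monoˡ-≤ (m ^ n) cm≤n ⟩
  n * m ^ n         ≤⟨ n*m^n≤m*[m+1]^n m n ⟩
  m * (m + 1) ^ n   ∎)
  where
  open ≤-Reasoning
  lemma : ∀ c m X → m * (c * X) ≡ c * m * X
  lemma = solve-∀

-- The correction k Y to the dominant term a Z costs one factor (a Z + k Y)^(k−1) ≤ (k Z)^(k−1).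
^-perturbation-≤ : ∀ a q Y Z → suc q * suc a * Y ≤ Z →
  suc q * (a * Z + suc a * Y) ^ suc a ≤ (suc q * a ^ suc a + suc a ^ suc a) * Z ^ suc a
^-perturbation-≤ a q Y Z qkY≤Z = begin
  q′ * V ^ k                                    ≤⟨ *-monoʳ-≤ q′ (^-≤-mean-value a (a * Z) (k * Y)) ⟩
  q′ * ((a * Z) ^ k + k * (k * Y * V ^ a))      ≡⟨ lemma₁ q′ k (k * Y) ((a * Z) ^ k) (V ^ a) ⟩
  q′ * (a * Z) ^ k + k * (q′ * (k * Y) * V ^ a) ≤⟨ +-monoʳ-≤ (q′ * (a * Z) ^ k) (*-monoʳ-≤ k (*-mono-≤ q′kY≤Z (^-monoˡ-≤ a V≤kZ))) ⟩
  q′ * (a * Z) ^ k + k * (Z * (k * Z) ^ a)      ≡⟨ cong₂ (λ x y → q′ * x + k * (Z * y)) (^-distribʳ-* a Z k) (^-distribʳ-* k Z a) ⟩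
  q′ * (a ^ k * Z ^ k) + k * (Z * (k ^ a * Z ^ a)) ≡⟨ lemma₂ q′ a (a ^ k) (Z ^ a) (k ^ a) Z ⟩
  (q′ * a ^ k + k ^ k) * Z ^ k                  ∎
  where
  open ≤-Reasoning
  k = suc a
  q′ = suc q
  V = a * Z + k * Y
  q′kY≤Z : q′ * (k * Y) ≤ Z
  q′kY≤Z = ≤-trans (≤-reflexive (sym (*-assoc q′ k Y))) qkY≤Z
  V≤kZ : V ≤ k * Z
  V≤kZ = ≤-trans (+-monoʳ-≤ (a * Z) (≤-trans (m≤n*m (k * Y) q′) q′kY≤Z)) (≤-reflexive (+-comm (a * Z) Z))
  lemma₁ : ∀ q k kY A W → q * (A + k * (kY * W)) ≡ q * A + k * (q * kY * W)
  lemma₁ = solve-∀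
  lemma₂ : ∀ q a Ak Za Ka Z → q * (Ak * (Z * Za)) + suc a * (Z * (Ka * Za)) ≡ (q * Ak + suc a * Ka) * (Z * Za)
  lemma₂ = solve-∀

count-bound⇒prod-≤ : ∀ a q n S P → suc q * suc a * suc (2 * a) ≤ n →
  suc a ^ n * S ≤ a * (2 * suc a) ^ n + suc a * suc (2 * a) ^ n →
  suc a ^ suc a * P ≤ S ^ suc a →
  suc q * (suc a ^ suc a * P) ≤ (suc q * a ^ suc a + suc a ^ suc a) * 2 ^ (suc a * n)
count-bound⇒prod-≤ a q n S P n-large count amgm = *-cancelˡ-≤ Kⁿ {{m^n≢0 (k ^ n) k {{m^n≢0 k n}}}} (begin
  Kⁿ * (q′ * (k ^ k * P))   ≤⟨ *-monoʳ-≤ Kⁿ (*-monoʳ-≤ q′ amgm) ⟩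
  Kⁿ * (q′ * S ^ k)         ≡⟨ *-Comm.x∙yz≈y∙xz Kⁿ q′ (S ^ k) ⟩
  q′ * (Kⁿ * S ^ k)         ≡⟨ cong (q′ *_) (^-distribʳ-* (k ^ n) S k) ⟨
  q′ * (k ^ n * S) ^ k      ≤⟨ *-monoʳ-≤ q′ (^-monoˡ-≤ k count) ⟩
  q′ * (a * Z + k * Y) ^ k  ≤⟨ ^-perturbation-≤ a q Y Z qkY≤Z ⟩
  C * Z ^ k                 ≡⟨ cong (λ x → C * x ^ k) (^-distribʳ-* 2 k n) ⟩
  C * (2 ^ n * k ^ n) ^ k   ≡⟨ cong (C *_) (^-distribʳ-* (2 ^ n) (k ^ n) k) ⟩
  C * ((2 ^ n) ^ k * Kⁿ)    ≡⟨ *-Comm.x∙yz≈z∙xy C ((2 ^ n) ^ k) Kⁿ ⟩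
  Kⁿ * (C * (2 ^ n) ^ k)    ≡⟨ cong (λ x → Kⁿ * (C * x)) (trans (^-*-assoc 2 n k) (cong (2 ^_) (*-comm n k))) ⟩
  Kⁿ * (C * 2 ^ (k * n))    ∎)
  where
  open ≤-Reasoning
  k = suc a
  q′ = suc q
  E = suc (2 * a)
  Kⁿ = (k ^ n) ^ k
  Z = (2 * k) ^ n
  Y = E ^ n
  C = q′ * a ^ k + k ^ k
  qkY≤Z : q′ * k * Y ≤ Z
  qkY≤Z = subst (λ x → q′ * k * Y ≤ x ^ n) (lemma a) (c*m^n≤[m+1]^n (q′ * k) E n n-large)
    where
    lemma : ∀ a → suc (2 * a) + 1 ≡ 2 * suc a
    lemma = solve-∀

toℚᵘ-toℚ : ∀ m → toℚᵘ (toℚ m) ℚᵘ.≃ mkℚᵘ (ℤ.+ m) 0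
toℚᵘ-toℚ m = ℚ.toℚᵘ-fromℚᵘ (mkℚᵘ (ℤ.+ m) 0)

toℚᵘ-/ℕ : ∀ m d → toℚᵘ (m /ℕ suc d) ℚᵘ.≃ mkℚᵘ (ℤ.+ m) d
toℚᵘ-/ℕ m d = ℚ.toℚᵘ-fromℚᵘ (mkℚᵘ (ℤ.+ m) d)

toℚᵘ-^ℚ : ∀ m d e → Σ ℕ λ d′ → suc d′ ≡ suc d ^ e × toℚᵘ ((m /ℕ suc d) ^ℚ e) ℚᵘ.≃ mkℚᵘ (ℤ.+ (m ^ e)) d′
toℚᵘ-^ℚ m d zero = 0 , refl , ℚᵘ.≃-refl
toℚᵘ-^ℚ m d (suc e) with toℚᵘ-^ℚ m d e
... | d′ , d′≡ , x^e≃ = d′ + d * suc d′ , cong (suc d *_) d′≡ ,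
  ℚᵘ.≃-trans (ℚ.toℚᵘ-homo-* (m /ℕ suc d) ((m /ℕ suc d) ^ℚ e))
    (ℚᵘ.≃-trans (ℚᵘ.*-cong (toℚᵘ-/ℕ m d) x^e≃)
      (ℚᵘ.≃-reflexive (cong (λ z → mkℚᵘ z (d′ + d * suc d′)) (sym (ℤ.pos-* m (m ^ e))))))

≤ᵘ-cross : ∀ {m n d e} → m * suc e ≤ n * suc d → mkℚᵘ (ℤ.+ m) d ℚᵘ.≤ mkℚᵘ (ℤ.+ n) e
≤ᵘ-cross {m} {n} {d} {e} le = *≤* (subst₂ ℤ._≤_ (ℤ.pos-* m (suc e)) (ℤ.pos-* n (suc d)) (ℤ.+≤+ le))

P≤ᵘ[A/K+ε]*T : ∀ A d′ p q T P →
  suc q * (suc d′ * P) ≤ (suc q * A + suc d′) * T →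
  mkℚᵘ (ℤ.+ P) 0 ℚᵘ.≤ (mkℚᵘ (ℤ.+ A) d′ ℚᵘ.+ mkℚᵘ (ℤ.+ suc p) q) ℚᵘ.* mkℚᵘ (ℤ.+ T) 0
P≤ᵘ[A/K+ε]*T A d′ p q T P hyp =
  ℚᵘ.≤-respʳ-≃ (ℚᵘ.≃-reflexive (cong (λ z → mkℚᵘ z _) (sym numerator≡))) (≤ᵘ-cross (begin
    P * (suc d′ * suc q * 1)  ≡⟨ lemma P (suc d′) (suc q) ⟩
    suc q * (suc d′ * P)      ≤⟨ hyp ⟩
    (suc q * A + suc d′) * T  ≤⟨ *-monoˡ-≤ T (+-mono-≤ (≤-reflexive (*-comm (suc q) A)) (m≤n*m (suc d′) (suc p))) ⟩
    N * T                     ≡⟨ *-identityʳ (N * T) ⟨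
    N * T * 1                 ∎))
  where
  open ≤-Reasoning
  N = A * suc q + suc p * suc d′
  numerator≡ : (ℤ.+ A ℤ.* ℤ.+ suc q ℤ.+ ℤ.+ suc p ℤ.* ℤ.+ suc d′) ℤ.* ℤ.+ T ≡ ℤ.+ (N * T)
  numerator≡ = trans (cong (ℤ._* ℤ.+ T) (trans (cong₂ ℤ._+_ (sym (ℤ.pos-* A (suc q))) (sym (ℤ.pos-* (suc p) (suc d′))))
                                               (sym (ℤ.pos-+ (A * suc q) (suc p * suc d′)))))
                     (sym (ℤ.pos-* N T))
  lemma : ∀ P d q → P * (d * q * 1) ≡ q * (d * P)
  lemma = solve-∀

P≤[x^e+ε]*T : ∀ m d e p q .(c : Coprime (suc p) (suc q)) T P →
  suc q * (suc d ^ e * P) ≤ (suc q * m ^ e + suc d ^ e) * T →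
  toℚ P ℚ.≤ ((m /ℕ suc d) ^ℚ e ℚ.+ ℚ.mkℚ (ℤ.+ suc p) q c) ℚ.* toℚ T
P≤[x^e+ε]*T m d e p q c T P hyp with toℚᵘ-^ℚ m d e
... | d′ , d′≡ , x^e≃ = ℚ.toℚᵘ-cancel-≤ (begin
  toℚᵘ (toℚ P)                                                 ≃⟨ toℚᵘ-toℚ P ⟩
  mkℚᵘ (ℤ.+ P) 0                                               ≤⟨ P≤ᵘ[A/K+ε]*T (m ^ e) d′ p q T P hyp′ ⟩
  (mkℚᵘ (ℤ.+ (m ^ e)) d′ ℚᵘ.+ mkℚᵘ (ℤ.+ suc p) q) ℚᵘ.* mkℚᵘ (ℤ.+ T) 0
                                                               ≃⟨ ℚᵘ.*-cong (ℚᵘ.+-cong x^e≃ ℚᵘ.≃-refl) (toℚᵘ-toℚ T) ⟨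
  (toℚᵘ x^e ℚᵘ.+ toℚᵘ ε) ℚᵘ.* toℚᵘ (toℚ T)                     ≃⟨ ℚᵘ.*-cong (ℚ.toℚᵘ-homo-+ x^e ε) ℚᵘ.≃-refl ⟨
  toℚᵘ (x^e ℚ.+ ε) ℚᵘ.* toℚᵘ (toℚ T)                           ≃⟨ ℚ.toℚᵘ-homo-* (x^e ℚ.+ ε) (toℚ T) ⟨
  toℚᵘ ((x^e ℚ.+ ε) ℚ.* toℚ T)                                 ∎)
  where
  open ℚᵘ.≤-Reasoning
  x^e = (m /ℕ suc d) ^ℚ e
  ε = ℚ.mkℚ (ℤ.+ suc p) q c
  hyp′ : suc q * (suc d′ * P) ≤ (suc q * m ^ e + suc d′) * T
  hyp′ = subst (λ K → suc q * (K * P) ≤ (suc q * m ^ e + K) * T) (sym d′≡) hyp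

[1/d-ε]*dP≤P : ∀ d ε → 0ℚ ℚ.≤ ε → ∀ P → ((1 /ℕ suc d) ℚ.- ε) ℚ.* toℚ (suc d * P) ℚ.≤ toℚ P
[1/d-ε]*dP≤P d ε 0≤ε P =
  ℚ.≤-trans (ℚ.*-monoʳ-≤-nonNeg (toℚ dP) {{ℚ.normalize-nonNeg dP 1}} 1/d-ε≤1/d) (ℚ.toℚᵘ-cancel-≤ (begin
    toℚᵘ ((1 /ℕ suc d) ℚ.* toℚ dP)             ≃⟨ ℚ.toℚᵘ-homo-* (1 /ℕ suc d) (toℚ dP) ⟩
    toℚᵘ (1 /ℕ suc d) ℚᵘ.* toℚᵘ (toℚ dP)       ≃⟨ ℚᵘ.*-cong (toℚᵘ-/ℕ 1 d) (toℚᵘ-toℚ dP) ⟩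
    mkℚᵘ (ℤ.+ 1) d ℚᵘ.* mkℚᵘ (ℤ.+ dP) 0         ≃⟨ ℚᵘ.≃-reflexive (cong (λ z → mkℚᵘ z (d * 1)) (ℤ.*-identityˡ (ℤ.+ dP))) ⟩
    mkℚᵘ (ℤ.+ dP) (d * 1)                      ≤⟨ ≤ᵘ-cross (≤-reflexive (lemma d P)) ⟩
    mkℚᵘ (ℤ.+ P) 0                             ≃⟨ toℚᵘ-toℚ P ⟨
    toℚᵘ (toℚ P)                               ∎))
  where
  open ℚᵘ.≤-Reasoning
  dP = suc d * P
  lemma : ∀ d P → suc d * P * 1 ≡ P * suc (d * 1)
  lemma = solve-∀
  1/d-ε≤1/d : (1 /ℕ suc d) ℚ.- ε ℚ.≤ 1 /ℕ suc d
  1/d-ε≤1/d = ℚ.≤-trans (ℚ.+-monoʳ-≤ (1 /ℕ suc d) (ℚ.neg-antimono-≤ 0≤ε)) (ℚ.≤-reflexive (ℚ.+-identityʳ (1 /ℕ suc d)))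

-- The extremal construction

allSubsets : ∀ n → List (Subset n)
allSubsets zero = [] ∷ []
allSubsets (suc n) = List.map (true ∷_) (allSubsets n) ++ List.map (false ∷_) (allSubsets n)

length-allSubsets : ∀ n → length (allSubsets n) ≡ 2 ^ n
length-allSubsets zero = refl
length-allSubsets (suc n) = begin
  length (withFirst true ++ withFirst false)           ≡⟨ length-++ (withFirst true) ⟩
  length (withFirst true) + length (withFirst false)   ≡⟨ cong₂ _+_ (length-withFirst true) (length-withFirst false) ⟩
  2 ^ n + 2 ^ n                                        ≡⟨ cong (2 ^ n +_) (+-identityʳ (2 ^ n)) ⟨
  2 ^ suc n                                            ∎
  where
  open ≡-Reasoning
  withFirst : Bool → List (Subset (suc n))
  withFirst b = List.map (b ∷_) (allSubsets n)
  length-withFirst : ∀ b → length (withFirst b) ≡ 2 ^ n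
  length-withFirst b = trans (length-map (b ∷_) (allSubsets n)) (length-allSubsets n)

allSubsets-unique : ∀ n → Unique (allSubsets n)
allSubsets-unique zero = [] ∷ []
allSubsets-unique (suc n) =
  ++⁺ (map⁺ ∷-injectiveʳ (allSubsets-unique n)) (map⁺ ∷-injectiveʳ (allSubsets-unique n)) disjoint
  where
  disjoint : ∀ {S} → S ∈ List.map (true ∷_) (allSubsets n) × S ∈ List.map (false ∷_) (allSubsets n) → ⊥
  disjoint (S∈₁ , S∈₂) with ∈-map⁻ (true ∷_) S∈₁ | ∈-map⁻ (false ∷_) S∈₂
  ... | _ , _ , refl | _ , _ , ()

containingFirst avoidingFirst : ∀ n → Family (suc n)
containingFirst n = family (List.map (true ∷_) (allSubsets n)) (map⁺ ∷-injectiveʳ (allSubsets-unique n))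
avoidingFirst n = family (List.map (false ∷_) (allSubsets n)) (map⁺ ∷-injectiveʳ (allSubsets-unique n))

allSets : ∀ n → Family n
allSets n = family (allSubsets n) (allSubsets-unique n)

lowerFamilies : ∀ m n → Fin (3 + m) → Family (suc n)
lowerFamilies m n zero = containingFirst n
lowerFamilies m n (suc zero) = containingFirst n
lowerFamilies m n (suc (suc zero)) = avoidingFirst n
lowerFamilies m n (suc (suc (suc _))) = allSets (suc n)

-- Petals 0 and 1 contain the first element and petal 2 avoids it, so the core would both
-- contain and avoid it.
lowerFamilies-sunflowerFree : ∀ m n → SunflowerFree (lowerFamilies m n)
lowerFamilies-sunflowerFree m n (A , C , A∈ , A∩A≡C , _)
  with ∈-map⁻ (true ∷_) (A∈ zero) | ∈-map⁻ (true ∷_) (A∈ (suc zero)) | ∈-map⁻ (false ∷_) (A∈ (suc (suc zero)))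
... | _ , _ , A₀≡ | _ , _ , A₁≡ | _ , _ , A₂≡
  with trans (sym (cong head (cong₂ _∩_ A₀≡ A₁≡))) (cong head (A∩A≡C zero (suc zero) λ ()))
     | trans (sym (cong head (cong₂ _∩_ A₀≡ A₂≡))) (cong head (A∩A≡C zero (suc (suc zero)) λ ()))
... | core-has-first | core-avoids-first with trans core-has-first (sym core-avoids-first)
... | ()

prodFin-const : ∀ k c → prodFin k (λ _ → c) ≡ c ^ k
prodFin-const zero c = refl
prodFin-const (suc k) c = cong (c *_) (prodFin-const k c)

8*prodCard-lowerFamilies : ∀ m n → 8 * prodCard (lowerFamilies m n) ≡ 2 ^ ((3 + m) * suc n)
8*prodCard-lowerFamilies m n = begin
  8 * (L₁ * (L₁ * (L₀ * prodFin m (λ _ → length (allSubsets (suc n))))))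
    ≡⟨ cong₂ (λ x y → 8 * (x * (x * y))) (length-first true)
             (cong₂ _*_ (length-first false) (trans (prodFin-const m _) (cong (_^ m) (length-allSubsets (suc n))))) ⟩
  8 * (H * (H * (H * (2 * H) ^ m)))          ≡⟨ lemma H ((2 * H) ^ m) ⟩
  2 * H * (2 * H * (2 * H * (2 * H) ^ m))    ≡⟨ ^-*-assoc 2 (suc n) (3 + m) ⟩
  2 ^ (suc n * (3 + m))                      ≡⟨ cong (2 ^_) (*-comm (suc n) (3 + m)) ⟩
  2 ^ ((3 + m) * suc n)                      ∎
  where
  open ≡-Reasoning
  H = 2 ^ n
  L₁ = length (List.map (true ∷_) (allSubsets n))
  L₀ = length (List.map (false ∷_) (allSubsets n))
  length-first : ∀ b → length (List.map (b ∷_) (allSubsets n)) ≡ H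
  length-first b = trans (length-map (b ∷_) (allSubsets n)) (length-allSubsets n)
  lemma : ∀ X Z → 8 * (X * (X * (X * Z))) ≡ (2 * X) * ((2 * X) * ((2 * X) * Z))
  lemma = solve-∀

lowerFamilies-prodCard-≥ : ∀ m n ε → 0ℚ ℚ.≤ ε →
  ((1 /ℕ 8) ℚ.- ε) ℚ.* toℚ (2 ^ ((3 + m) * suc n)) ℚ.≤ toℚ (prodCard (lowerFamilies m n))
lowerFamilies-prodCard-≥ m n ε 0≤ε =
  subst (λ T → ((1 /ℕ 8) ℚ.- ε) ℚ.* toℚ T ℚ.≤ toℚ (prodCard (lowerFamilies m n)))
        (8*prodCard-lowerFamilies m n) ([1/d-ε]*dP≤P 7 ε 0≤ε (prodCard (lowerFamilies m n)))

sunflowerFree⇒prodCard-≤ : ∀ a p q .(c : Coprime (suc p) (suc q)) n → suc q * suc a * suc (2 * a) ≤ n →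
  (𝒜 : Fin (suc a) → Family n) → SunflowerFree 𝒜 →
  toℚ (prodCard 𝒜) ℚ.≤ ((a /ℕ suc a) ^ℚ suc a ℚ.+ ℚ.mkℚ (ℤ.+ suc p) q c) ℚ.* toℚ (2 ^ (suc a * n))
sunflowerFree⇒prodCard-≤ a p q c n n-large 𝒜 𝒜-sunflowerFree =
  P≤[x^e+ε]*T a a (suc a) p q c (2 ^ (suc a * n)) (prodCard 𝒜)
    (count-bound⇒prod-≤ a q n (sum (λ i → card (𝒜 i))) (prodCard 𝒜) n-large
      (LabelledCube.sum-card-≤ a 𝒜 𝒜-sunflowerFree) (am-gm (suc a) (λ i → card (𝒜 i))))

corollary1 : (k : ℕ) → 3 ≤ k →
    (ε : ℚ) → Positive ε →
    Σ ℕ λ N → (n : ℕ) → N ≤ n →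
      (Σ (Fin k → Family n) λ 𝒜 → SunflowerFree 𝒜 ×
          (((1 /ℕ 8) -ℚ ε) *ℚ toℚ (2 ^ (k * n)) ≤ℚ toℚ (prodCard 𝒜)))
      × ((𝒜 : Fin k → Family n) → SunflowerFree 𝒜 →
          toℚ (prodCard 𝒜) ≤ℚ ((((k ∸ 1) /ℕ k) ^ℚ k) +ℚ ε) *ℚ toℚ (2 ^ (k * n)))
corollary1 (suc (suc (suc m))) (s≤s (s≤s (s≤s _))) ε@(ℚ.mkℚ (ℤ.+ suc p) q c) _ =
  suc q * (3 + m) * suc (2 * suc (suc m)) , λ where
  (suc n) n-large →
    (lowerFamilies m n , lowerFamilies-sunflowerFree m n , lowerFamilies-prodCard-≥ m n ε (ℚ.*≤* (ℤ.+≤+ z≤n))) ,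
    sunflowerFree⇒prodCard-≤ (suc (suc m)) p q c (suc n) n-large
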